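{- Let $\mathbf{s}$ be a Sturmian word of slope $\theta$ with words $V_k$ ($k\ge-1$) and formal intercept $(b^*_k)_{k\ge1}$ as in the context. Then $V_1=V_0^{a_1-1-b^*_1}V_{ -1}V_0^{b^*_1}$, and for every $k\ge1$, $$V_{k+1}=V_k^{a_{k+1}-b^*_{k+1}}\,V_{k-1}\,V_k^{b^*_{k+1}}.$$
   Context: Let $\theta=[0;a_1,a_2,\dots]\in(0,1)$ be irrational with $q_{ -1}=0$, $q_0=1$, $q_k=a_kq_{k-1}+q_{k-2}$. Words over $\{0,1\}$: $M_0=0$, $M_1=0^{a_1-1}1$, $M_k=M_{k-1}^{a_k}M_{k-2}$ ($k\ge2$), $|M_k|=q_k$. A Sturmian word of slope $\theta$ is $s_1s_2\cdots$ or $s'_1s'_2\cdots$ for some $\rho\in[0,1)$, with $s_n=\lfloor n\theta+\rho\rfloor-\lfloor(n-1)\theta+\rho\rfloor$, $s'_n=\lceil n\theta+\rho\rceil-\lceil(n-1)\theta+\rho\rceil$. A conjugate of $M_k$ is a word $V=RT$ with $M_k=TR$, $0\le|T|<q_k$. For $k\ge1$, $V_k$ is the conjugate of $M_k$ whose first $q_k-1$ letters coincide with those of $\mathbf{s}$, written $V_k=R_kT_k$ with $M_k=T_kR_k$, $R_k$ non-empty, $t_k=|T_k|$; also $V_{ -1}=1$, $V_0=0$, $t_0=0$. The formal intercept is defined by $b^*_1=t_1$ and $b^*_{k+1}=(t_{k+1}-t_k)/q_k$ for $k\ge1$ (these are integers with $0\le b^*_{k+1}\le a_{k+1}$). -}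

module Defs where

open import Data.Nat as ℕ using (ℕ; zero; suc; _∸_)
open import Data.Nat.DivMod using (_/_)
open import Data.Integer as ℤ using (ℤ; +_)
open import Data.Rational as ℚ using (ℚ)
open import Data.List using (List; []; _∷_; _++_; concat; replicate; take; drop; map; upTo)
open import Data.Product using (Σ; ∃; _×_; _,_)
open import Data.Sum using (_⊎_)
open import Relation.Nullary using (¬_)
open import Relation.Binary.PropositionalEquality using (_≡_)

-- Real numbers as two-sided Dedekind cuts of ℚ (no reals in stdlib).
-- L q  means  q < x ;  U q  means  x < q.

record Real : Set₁ where
  field
    L U        : ℚ → Set
    L-inhabited : ∃ λ q → L q
    U-inhabited : ∃ λ q → U q
    L-rounded₁ : ∀ p q → p ℚ.< q → L q → L p
    L-rounded₂ : ∀ q → L q → ∃ λ r → q ℚ.< r × L r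
    U-rounded₁ : ∀ p q → p ℚ.< q → U p → U q
    U-rounded₂ : ∀ q → U q → ∃ λ r → r ℚ.< q × U r
    disjoint   : ∀ q → ¬ (L q × U q)
    located    : ∀ p q → p ℚ.< q → L p ⊎ U q

-- Continued fraction data.  a : ℕ → ℕ, with a k = a_k for k ≥ 1
-- (a 0 is unused; the partial quotients are assumed ≥ 1).

-- q k = q_k for k ≥ 0  (q_{-1} = 0, q_0 = 1, q_k = a_k q_{k-1} + q_{k-2})
q : (ℕ → ℕ) → ℕ → ℕ
q a 0 = 1
q a 1 = a 1
q a (suc (suc k)) = a (suc (suc k)) ℕ.* q a (suc k) ℕ.+ q a k

-- p k = p_k for k ≥ 0  (p_{-1} = 1, p_0 = 0 ; numerators of convergents)
p : (ℕ → ℕ) → ℕ → ℕ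
p a 0 = 0
p a 1 = 1
p a (suc (suc k)) = a (suc (suc k)) ℕ.* p a (suc k) ℕ.+ p a k

ℕtoℚ : ℕ → ℚ
ℕtoℚ n = ℚ._/_ (+ n) 1

ℤtoℚ : ℤ → ℚ
ℤtoℚ m = ℚ._/_ m 1

-- The cut of θ = [0; a_1, a_2, ...]: θ is the supremum of the even
-- convergents p_{2k}/q_{2k} and the infimum of the odd ones.
θL : (ℕ → ℕ) → ℚ → Set
θL a v = ∃ λ k → ℕtoℚ (q a (2 ℕ.* k)) ℚ.* v ℚ.< ℕtoℚ (p a (2 ℕ.* k))

θU : (ℕ → ℕ) → ℚ → Set
θU a v = ∃ λ k → ℕtoℚ (p a (suc (2 ℕ.* k))) ℚ.< ℕtoℚ (q a (suc (2 ℕ.* k))) ℚ.* v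

-- cuts of the real  n θ + ρ
xU : (ℕ → ℕ) → Real → ℕ → ℚ → Set
xU a ρ n c = ∃ λ u → ∃ λ v → Real.U ρ u × θU a v × (ℕtoℚ n ℚ.* v ℚ.+ u ℚ.< c)

xL : (ℕ → ℕ) → Real → ℕ → ℚ → Set
xL a ρ n c = ∃ λ l → ∃ λ w → Real.L ρ l × θL a w × (c ℚ.< ℕtoℚ n ℚ.* w ℚ.+ l)

-- m = ⌊ n θ + ρ ⌋   i.e.  m ≤ nθ+ρ < m+1
IsFloor : (ℕ → ℕ) → Real → ℕ → ℤ → Set
IsFloor a ρ n m = ¬ xU a ρ n (ℤtoℚ m) × xU a ρ n (ℤtoℚ (m ℤ.+ + 1))

-- m = ⌈ n θ + ρ ⌉   i.e.  m-1 < nθ+ρ ≤ m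
IsCeil : (ℕ → ℕ) → Real → ℕ → ℤ → Set
IsCeil a ρ n m = xL a ρ n (ℤtoℚ (m ℤ.- + 1)) × ¬ xL a ρ n (ℤtoℚ m)

-- Infinite words over {0,1} are functions s : ℕ → ℕ with s i = s_{i+1}.
-- s is a Sturmian word of slope θ=[0;a_1,a_2,...]: for some ρ ∈ [0,1),
-- s_n = ⌊nθ+ρ⌋ - ⌊(n-1)θ+ρ⌋ for all n ≥ 1, or the same with ⌈ ⌉.
Sturmian : (ℕ → ℕ) → (ℕ → ℕ) → Set₁
Sturmian a s = Σ Real λ ρ → ¬ Real.U ρ (ℕtoℚ 0) × Real.U ρ (ℕtoℚ 1) ×
  ( (Σ (ℕ → ℤ) λ f → (∀ n → IsFloor a ρ n (f n)) × (∀ i → + (s i) ≡ f (suc i) ℤ.- f i))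
  ⊎ (Σ (ℕ → ℤ) λ f → (∀ n → IsCeil a ρ n (f n)) × (∀ i → + (s i) ≡ f (suc i) ℤ.- f i)) )

Word : Set
Word = List ℕ

_^ʷ_ : Word → ℕ → Word
w ^ʷ n = concat (replicate n w)

M : (ℕ → ℕ) → ℕ → Word
M a 0 = 0 ∷ []
M a 1 = (0 ∷ []) ^ʷ (a 1 ∸ 1) ++ 1 ∷ []
M a (suc (suc k)) = M a (suc k) ^ʷ a (suc (suc k)) ++ M a k

conj : Word → ℕ → Word
conj w t = drop t w ++ take t w

prefix : (ℕ → ℕ) → ℕ → Word
prefix s n = map s (upTo n)

-- t : ℕ → ℕ with t k = t_k is a valid choice of the V_k (k ≥ 1):
-- t_0 = 0 and, for k ≥ 1, 0 ≤ t_k < q_k and the conjugate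
-- V_k = R_k T_k of M_k = T_k R_k (|T_k| = t_k) has its first q_k - 1
-- letters equal to those of s.
IsVt : (ℕ → ℕ) → (ℕ → ℕ) → (ℕ → ℕ) → Set
IsVt a s t = t 0 ≡ 0 ×
  (∀ k → t (suc k) ℕ.< q a (suc k) ×
         take (q a (suc k) ∸ 1) (conj (M a (suc k)) (t (suc k))) ≡ prefix s (q a (suc k) ∸ 1))

-- V t k = V_k for k ≥ 0  (V_0 = 0);  V_{-1} = 1 is written out directly.
V : (ℕ → ℕ) → (ℕ → ℕ) → ℕ → Word
V a t 0 = 0 ∷ []
V a t (suc k) = conj (M a (suc k)) (t (suc k))

-- division with m / 0 := 0 (only used with nonzero divisors q_k)
_div_ : ℕ → ℕ → ℕ
m div zero = 0
m div suc n = m / suc n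

bstar : (ℕ → ℕ) → (ℕ → ℕ) → ℕ → ℕ
bstar a t 0 = 0
bstar a t 1 = t 1
bstar a t (suc (suc k)) = (t (suc (suc k)) ∸ t (suc k)) div q a (suc k)

-- Write M_k = T_k R_k with |T_k| = t_k, so that V_k = R_k T_k.  The heart of the proof is
-- t_{k+1} ≡ t_k (mod q_k).  Since M_{k-1} M_k and M_k M_{k-1} differ only in their last two
-- letters, M_{k+1} M_{k+1} has period q_k on its first (a_{k+1} + 1) q_k + q_{k-1} - 2 letters;
-- hence the q_k - 1 letters of M_{k+1} M_{k+1} from position t_{k+1} are those of M_k M_k from
-- position t_{k+1} mod q_k.  Both V_{k+1} and V_k begin like s, and the conjugates of M_k are
-- told apart by their first q_k - 1 letters, because gcd (q_k, p_k) = 1 makes M_k primitive.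
-- So t_{k+1} = b q_k + t_k with b = b*_{k+1} ≤ a_{k+1}, and T_{k+1} = M_k^b T_k.  The latter
-- propagates the relation M_{k-1} T_k = T_k V_{k-1}, which is exactly what turns the rotation
-- of M_{k+1} = M_k^{a_{k+1}} M_{k-1} by b q_k + t_k into V_k^{a_{k+1} - b} V_{k-1} V_k^b.
module Submission where

open import Defs
open import Data.Nat using (>-nonZero; ℕ; zero; suc; _+_; _*_; _∸_; _≤_; _<_; z≤n; s≤s)
open import Data.Nat.Properties
open import Data.Nat.DivMod using (_/_; _%_; m%n<n; m≡m%n+[m/n]*n; m*n/n≡m)
open import Data.Nat.Coprimality using (Coprime)
open import Data.Nat.Divisibility using (_∣_; divides; ∣m+n∣m⇒∣n; ∣1⇒≡1; ∣m⇒∣m*n; ∣n⇒∣m*n)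
open import Data.Nat.ListAction using (sum)
open import Data.Nat.ListAction.Properties using (sum-++)
open import Data.List using (List; []; _∷_; _++_; length; take; drop; map; upTo; applyUpTo)
open import Data.List.Properties
  using (++-assoc; ++-identityʳ; ++-cancelˡ; length-++; length-take; length-drop; take-take;
         take-drop; take-[]; drop-drop; take++drop≡id; take-map; ∷-injectiveˡ; ∷-injectiveʳ)
open import Data.Product using (∃; ∃₂; _×_; _,_; proj₁; proj₂)
open import Data.Sum using (_⊎_; inj₁; inj₂)
open import Relation.Nullary using (¬_; contradiction)
open import Relation.Binary.PropositionalEquality
open ≡-Reasoning

private variable A : Set

quotient-remainder : ∀ m {n} → 1 ≤ n → ∃₂ λ b i → i < n × m ≡ b * n + i
quotient-remainder m {suc n} _ =
  m / suc n , m % suc n , m%n<n m (suc n) ,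
  trans (m≡m%n+[m/n]*n m (suc n)) (+-comm (m % suc n) _)

quotient-≤ : ∀ {b i n c r} → b * n + i < c * n + r → r ≤ n → b ≤ c
quotient-≤ {b} {i} {n} {c} {r} lt r≤n = ≤-pred (*-cancelʳ-< n b (suc c)
  (≤-<-trans (m≤m+n (b * n) i)
    (<-≤-trans lt (≤-trans (+-monoʳ-≤ (c * n) r≤n) (≤-reflexive (+-comm (c * n) n))))))

*-div-cancel : ∀ m {n} → 1 ≤ n → (m * n) div n ≡ m
*-div-cancel m {suc n} _ = m*n/n≡m m (suc n)

+-suc-shift : ∀ x {m n} → m ≡ n + 1 → x + m ≡ x + n + 1
+-suc-shift x m≡ = trans (cong (x +_) m≡) (sym (+-assoc x _ 1))

-- Lists agreeing on a prefix

infix 4 _≡[_]_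

_≡[_]_ : List A → ℕ → List A → Set
xs ≡[ n ] ys = take n xs ≡ take n ys

length-take-≤ : ∀ {n} (xs : List A) → n ≤ length xs → length (take n xs) ≡ n
length-take-≤ {n = n} xs n≤ = trans (length-take n xs) (m≤n⇒m⊓n≡m n≤)

take-take-≤ : ∀ {m n} (xs : List A) → m ≤ n → take m (take n xs) ≡ take m xs
take-take-≤ {m = m} {n} xs m≤n =
  trans (take-take m n xs) (cong (λ k → take k xs) (m≤n⇒m⊓n≡m m≤n))

take-++ˡ : ∀ {n} (xs ys : List A) → n ≤ length xs → take n (xs ++ ys) ≡ take n xs
take-++ˡ {n = zero}  xs       ys _         = refl
take-++ˡ {n = suc n} (x ∷ xs) ys (s≤s n≤) = cong (x ∷_) (take-++ˡ xs ys n≤)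

drop-++ˡ : ∀ {n} (xs ys : List A) → n ≤ length xs → drop n (xs ++ ys) ≡ drop n xs ++ ys
drop-++ˡ {n = zero}  xs       ys _         = refl
drop-++ˡ {n = suc n} (x ∷ xs) ys (s≤s n≤) = drop-++ˡ xs ys n≤

take-length : ∀ (xs ys : List A) → take (length xs) (xs ++ ys) ≡ xs
take-length []       ys = refl
take-length (x ∷ xs) ys = cong (x ∷_) (take-length xs ys)

drop-length : ∀ (xs ys : List A) → drop (length xs) (xs ++ ys) ≡ ys
drop-length []       ys = refl
drop-length (x ∷ xs) ys = drop-length xs ys

take-length-+ : ∀ (xs ys : List A) n → take (length xs + n) (xs ++ ys) ≡ xs ++ take n ys
take-length-+ []       ys n = refl
take-length-+ (x ∷ xs) ys n = cong (x ∷_) (take-length-+ xs ys n)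

drop-length-+ : ∀ (xs ys : List A) n → drop (length xs + n) (xs ++ ys) ≡ drop n ys
drop-length-+ []       ys n = refl
drop-length-+ (x ∷ xs) ys n = drop-length-+ xs ys n

take-+ : ∀ m n (xs : List A) → take (m + n) xs ≡ take m xs ++ take n (drop m xs)
take-+ zero    n xs       = refl
take-+ (suc m) n []       = sym (take-[] n)
take-+ (suc m) n (x ∷ xs) = cong (x ∷_) (take-+ m n xs)

take-drop-++ : ∀ {i} (xs ys : List A) → i ≤ length xs →
               take (length xs) (drop i (xs ++ ys)) ≡ drop i xs ++ take i ys
take-drop-++ {i = i} xs ys i≤ = begin
  take (length xs) (drop i (xs ++ ys))            ≡⟨ cong₂ take |xs| (drop-++ˡ xs ys i≤) ⟩
  take (length (drop i xs) + i) (drop i xs ++ ys) ≡⟨ take-length-+ (drop i xs) ys i ⟩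
  drop i xs ++ take i ys                          ∎
  where
  |xs| : length xs ≡ length (drop i xs) + i
  |xs| = sym (trans (cong (_+ i) (length-drop i xs)) (m∸n+n≡m i≤))

take-applyUpTo : ∀ (f : ℕ → A) {m n} → m ≤ n → take m (applyUpTo f n) ≡ applyUpTo f m
take-applyUpTo f {zero}  _          = refl
take-applyUpTo f {suc m} (s≤s m≤n) = cong (f 0 ∷_) (take-applyUpTo (λ i → f (suc i)) m≤n)

take-prefix : ∀ (s : ℕ → ℕ) {m n} → m ≤ n → take m (prefix s n) ≡ prefix s m
take-prefix s {m} {n} m≤n =
  trans (take-map m (upTo n)) (cong (map s) (take-applyUpTo (λ i → i) m≤n))

≡[]-cong : ∀ {n n′} {xs xs′ ys ys′ : List A} → xs ≡ xs′ → n ≡ n′ → ys ≡ ys′ →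
           xs ≡[ n ] ys → xs′ ≡[ n′ ] ys′
≡[]-cong refl refl refl eq = eq

≡[]-mono : ∀ {m n} {xs ys : List A} → m ≤ n → xs ≡[ n ] ys → xs ≡[ m ] ys
≡[]-mono {m = m} {xs = xs} {ys} m≤n eq =
  trans (sym (take-take-≤ xs m≤n)) (trans (cong (take m) eq) (take-take-≤ ys m≤n))

≡[]-++ : ∀ {n} (zs : List A) {xs ys} → xs ≡[ n ] ys → zs ++ xs ≡[ length zs + n ] zs ++ ys
≡[]-++ {n = n} zs {xs} {ys} eq =
  trans (take-length-+ zs xs n) (trans (cong (zs ++_) eq) (sym (take-length-+ zs ys n)))

≡[]-drop : ∀ j {n} {xs ys : List A} → xs ≡[ j + n ] ys → drop j xs ≡[ n ] drop j ys
≡[]-drop j {n} {xs} {ys} eq =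
  trans (take-drop n j xs) (trans (cong (drop j) eq) (sym (take-drop n j ys)))

≡-from-init-sum : (xs ys : List ℕ) → length xs ≡ length ys → xs ≡[ length xs ∸ 1 ] ys →
                  sum xs ≡ sum ys → xs ≡ ys
≡-from-init-sum []       []       _ _ _  = refl
≡-from-init-sum (x ∷ []) (y ∷ []) _ _ Σ≡ =
  cong (_∷ []) (trans (sym (+-identityʳ x)) (trans Σ≡ (+-identityʳ y)))
≡-from-init-sum (x ∷ xs@(_ ∷ _)) (y ∷ ys@(_ ∷ _)) |≡| init Σ≡ =
  cong₂ _∷_ x≡y (≡-from-init-sum xs ys (suc-injective |≡|) (∷-injectiveʳ init)
                   (+-cancelˡ-≡ x _ _ (trans Σ≡ (cong (_+ sum ys) (sym x≡y)))))
  where x≡y = ∷-injectiveˡ init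

-- Powers and conjugates of words

^ʷ-+ : ∀ (w : Word) m n → w ^ʷ (m + n) ≡ w ^ʷ m ++ w ^ʷ n
^ʷ-+ w zero    n = refl
^ʷ-+ w (suc m) n = trans (cong (w ++_) (^ʷ-+ w m n)) (sym (++-assoc w (w ^ʷ m) (w ^ʷ n)))

^ʷ-comm : ∀ (w : Word) n → w ++ w ^ʷ n ≡ w ^ʷ n ++ w
^ʷ-comm w n = begin
  w ^ʷ (1 + n)        ≡⟨ cong (w ^ʷ_) (+-comm 1 n) ⟩
  w ^ʷ (n + 1)        ≡⟨ ^ʷ-+ w n 1 ⟩
  w ^ʷ n ++ w ++ []   ≡⟨ cong (w ^ʷ n ++_) (++-identityʳ w) ⟩
  w ^ʷ n ++ w         ∎

^ʷ-pred : ∀ (w : Word) {n} → 1 ≤ n → w ^ʷ n ≡ w ++ w ^ʷ (n ∸ 1)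
^ʷ-pred w {suc n} _ = refl

length-^ʷ : ∀ (w : Word) n → length (w ^ʷ n) ≡ n * length w
length-^ʷ w zero    = refl
length-^ʷ w (suc n) = trans (length-++ w) (cong (length w +_) (length-^ʷ w n))

sum-^ʷ : ∀ (w : Word) n → sum (w ^ʷ n) ≡ n * sum w
sum-^ʷ w zero    = refl
sum-^ʷ w (suc n) = trans (sum-++ w (w ^ʷ n)) (cong (sum w +_) (sum-^ʷ w n))

length-letter^ʷ : ∀ c n → length ((c ∷ []) ^ʷ n) ≡ n
length-letter^ʷ c n = trans (length-^ʷ (c ∷ []) n) (*-identityʳ n)

^ʷ-shift : ∀ (u v : Word) n → (u ++ v) ^ʷ n ++ u ≡ u ++ (v ++ u) ^ʷ n
^ʷ-shift u v zero    = sym (++-identityʳ u)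
^ʷ-shift u v (suc n) = begin
  ((u ++ v) ++ (u ++ v) ^ʷ n) ++ u ≡⟨ ++-assoc (u ++ v) _ u ⟩
  (u ++ v) ++ ((u ++ v) ^ʷ n ++ u) ≡⟨ cong ((u ++ v) ++_) (^ʷ-shift u v n) ⟩
  (u ++ v) ++ (u ++ (v ++ u) ^ʷ n) ≡⟨ ++-assoc u v _ ⟩
  u ++ (v ++ (u ++ (v ++ u) ^ʷ n)) ≡⟨ cong (u ++_) (++-assoc v u _) ⟨
  u ++ ((v ++ u) ++ (v ++ u) ^ʷ n) ∎

^ʷ-++-square : ∀ (w : Word) {b n} → b ≤ n →
               w ^ʷ n ++ (w ++ w) ≡ w ^ʷ b ++ (w ++ (w ++ w ^ʷ (n ∸ b)))
^ʷ-++-square w {b} {n} b≤n = begin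
  w ^ʷ n ++ (w ++ w)             ≡⟨ cong (λ m → w ^ʷ m ++ (w ++ w)) (m+[n∸m]≡n b≤n) ⟨
  w ^ʷ (b + c) ++ (w ++ w)       ≡⟨ cong (_++ (w ++ w)) (^ʷ-+ w b c) ⟩
  (w ^ʷ b ++ w ^ʷ c) ++ (w ++ w) ≡⟨ ++-assoc (w ^ʷ b) _ _ ⟩
  w ^ʷ b ++ (w ^ʷ c ++ (w ++ w)) ≡⟨ cong (w ^ʷ b ++_) (++-assoc (w ^ʷ c) w w) ⟨
  w ^ʷ b ++ ((w ^ʷ c ++ w) ++ w) ≡⟨ cong (λ v → w ^ʷ b ++ (v ++ w)) (^ʷ-comm w c) ⟨
  w ^ʷ b ++ ((w ++ w ^ʷ c) ++ w) ≡⟨ cong (w ^ʷ b ++_) (++-assoc w (w ^ʷ c) w) ⟩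
  w ^ʷ b ++ (w ++ (w ^ʷ c ++ w)) ≡⟨ cong (λ v → w ^ʷ b ++ (w ++ v)) (^ʷ-comm w c) ⟨
  w ^ʷ b ++ (w ++ (w ++ w ^ʷ c)) ∎
  where c = n ∸ b

^ʷ-conjugate : ∀ (u v m x : Word) c b → m ++ u ≡ u ++ x →
               (((u ++ v) ^ʷ c ++ m) ++ (u ++ v) ^ʷ b) ++ u
                 ≡ u ++ ((v ++ u) ^ʷ c ++ x ++ (v ++ u) ^ʷ b)
^ʷ-conjugate u v m x c b mu≡ux = begin
  ((w ^ʷ c ++ m) ++ w ^ʷ b) ++ u    ≡⟨ ++-assoc (w ^ʷ c ++ m) _ u ⟩
  (w ^ʷ c ++ m) ++ (w ^ʷ b ++ u)    ≡⟨ cong ((w ^ʷ c ++ m) ++_) (^ʷ-shift u v b) ⟩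
  (w ^ʷ c ++ m) ++ (u ++ w′ ^ʷ b)   ≡⟨ ++-assoc (w ^ʷ c) m _ ⟩
  w ^ʷ c ++ (m ++ (u ++ w′ ^ʷ b))   ≡⟨ cong (w ^ʷ c ++_) (++-assoc m u _) ⟨
  w ^ʷ c ++ ((m ++ u) ++ w′ ^ʷ b)   ≡⟨ cong (λ y → w ^ʷ c ++ (y ++ w′ ^ʷ b)) mu≡ux ⟩
  w ^ʷ c ++ ((u ++ x) ++ w′ ^ʷ b)   ≡⟨ cong (w ^ʷ c ++_) (++-assoc u x _) ⟩
  w ^ʷ c ++ (u ++ (x ++ w′ ^ʷ b))   ≡⟨ ++-assoc (w ^ʷ c) u _ ⟨
  (w ^ʷ c ++ u) ++ (x ++ w′ ^ʷ b)   ≡⟨ cong (_++ (x ++ w′ ^ʷ b)) (^ʷ-shift u v c) ⟩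
  (u ++ w′ ^ʷ c) ++ (x ++ w′ ^ʷ b)  ≡⟨ ++-assoc u _ _ ⟩
  u ++ (w′ ^ʷ c ++ x ++ w′ ^ʷ b)    ∎
  where
  w = u ++ v
  w′ = v ++ u

length-conj : ∀ (w : Word) i → length (conj w i) ≡ length w
length-conj w i = begin
  length (drop i w ++ take i w)         ≡⟨ length-++ (drop i w) ⟩
  length (drop i w) + length (take i w) ≡⟨ +-comm (length (drop i w)) _ ⟩
  length (take i w) + length (drop i w) ≡⟨ length-++ (take i w) ⟨
  length (take i w ++ drop i w)         ≡⟨ cong length (take++drop≡id i w) ⟩
  length w                              ∎

sum-conj : ∀ (w : Word) i → sum (conj w i) ≡ sum w
sum-conj w i = begin
  sum (drop i w ++ take i w)      ≡⟨ sum-++ (drop i w) _ ⟩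
  sum (drop i w) + sum (take i w) ≡⟨ +-comm (sum (drop i w)) _ ⟩
  sum (take i w) + sum (drop i w) ≡⟨ sum-++ (take i w) _ ⟨
  sum (take i w ++ drop i w)      ≡⟨ cong sum (take++drop≡id i w) ⟩
  sum w                           ∎

conj-++ : ∀ (u v : Word) → conj (u ++ v) (length u) ≡ v ++ u
conj-++ u v = cong₂ _++_ (drop-length u v) (take-length u v)

conj-conj : ∀ (w : Word) i j → i + j ≤ length w → conj (conj w i) j ≡ conj w (i + j)
conj-conj w i j i+j≤ = begin
  drop j (drop i w ++ take i w) ++ take j (drop i w ++ take i w)
    ≡⟨ cong₂ _++_ (drop-++ˡ (drop i w) (take i w) j≤) (take-++ˡ (drop i w) (take i w) j≤) ⟩
  (drop j (drop i w) ++ take i w) ++ take j (drop i w)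
    ≡⟨ ++-assoc (drop j (drop i w)) (take i w) _ ⟩
  drop j (drop i w) ++ (take i w ++ take j (drop i w))
    ≡⟨ cong₂ _++_ (drop-drop i j w) (sym (take-+ i j w)) ⟩
  drop (i + j) w ++ take (i + j) w ∎
  where
  j≤ : j ≤ length (drop i w)
  j≤ = subst (j ≤_) (sym (length-drop i w))
         (subst (_≤ length w ∸ i) (m+n∸m≡n i j) (∸-monoˡ-≤ i i+j≤))

conjugate⇒conj : ∀ (w u x : Word) → w ++ u ≡ u ++ x → length u ≤ length w → conj w (length u) ≡ x
conjugate⇒conj w u x wu≡ux u≤w = ++-cancelˡ u _ _ (begin
  u ++ (drop n w ++ take n w)     ≡⟨ cong (λ y → u ++ (drop n w ++ y)) u-prefix ⟩
  u ++ (drop n w ++ u)            ≡⟨ ++-assoc u (drop n w) u ⟨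
  (u ++ drop n w) ++ u            ≡⟨ cong (λ y → (y ++ drop n w) ++ u) u-prefix ⟨
  (take n w ++ drop n w) ++ u     ≡⟨ cong (_++ u) (take++drop≡id n w) ⟩
  w ++ u                          ≡⟨ wu≡ux ⟩
  u ++ x                          ∎)
  where
  n = length u
  u-prefix : take n w ≡ u
  u-prefix = trans (sym (take-++ˡ w u u≤w)) (trans (cong (take n) wu≡ux) (take-length u x))

^ʷ-take-conjugate : ∀ (w : Word) b r →
                    w ++ (w ^ʷ b ++ take r w) ≡ (w ^ʷ b ++ take r w) ++ conj w r
^ʷ-take-conjugate w b r = begin
  w ++ (w ^ʷ b ++ u)          ≡⟨ ++-assoc w (w ^ʷ b) u ⟨
  (w ++ w ^ʷ b) ++ u          ≡⟨ cong (_++ u) (^ʷ-comm w b) ⟩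
  (w ^ʷ b ++ w) ++ u          ≡⟨ ++-assoc (w ^ʷ b) w u ⟩
  w ^ʷ b ++ (w ++ u)          ≡⟨ cong (λ y → w ^ʷ b ++ (y ++ u)) (take++drop≡id r w) ⟨
  w ^ʷ b ++ ((u ++ v) ++ u)   ≡⟨ cong (w ^ʷ b ++_) (++-assoc u v u) ⟩
  w ^ʷ b ++ (u ++ (v ++ u))   ≡⟨ ++-assoc (w ^ʷ b) u _ ⟨
  (w ^ʷ b ++ u) ++ (v ++ u)   ∎
  where
  u = take r w
  v = drop r w

conj-^ʷ-++ : ∀ (w m x : Word) {n b r} → b ≤ n → r ≤ length w →
             b * length w + r ≤ length (w ^ʷ n ++ m) → m ++ take r w ≡ take r w ++ x →
             conj (w ^ʷ n ++ m) (b * length w + r) ≡ conj w r ^ʷ (n ∸ b) ++ x ++ conj w r ^ʷ b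
conj-^ʷ-++ w m x {n} {b} {r} b≤n r≤w fits mu≡ux = begin
  conj (w ^ʷ n ++ m) (b * length w + r)       ≡⟨ conj-conj (w ^ʷ n ++ m) (b * length w) r fits ⟨
  conj (conj (w ^ʷ n ++ m) (b * length w)) r  ≡⟨ cong (λ y → conj y r) rotate ⟩
  conj z r                                    ≡⟨ cong (conj z) (length-take-≤ w r≤w) ⟨
  conj z (length u)                           ≡⟨ conjugate⇒conj z u _ zu≡uy u≤z ⟩
  conj w r ^ʷ (n ∸ b) ++ x ++ conj w r ^ʷ b   ∎
  where
  u = take r w
  z = (w ^ʷ (n ∸ b) ++ m) ++ w ^ʷ b
  split : w ^ʷ n ++ m ≡ w ^ʷ b ++ (w ^ʷ (n ∸ b) ++ m)
  split = trans (cong (λ k → w ^ʷ k ++ m) (sym (m+[n∸m]≡n b≤n)))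
            (trans (cong (_++ m) (^ʷ-+ w b (n ∸ b))) (++-assoc (w ^ʷ b) _ m))
  rotate : conj (w ^ʷ n ++ m) (b * length w) ≡ z
  rotate = trans (cong₂ conj split (sym (length-^ʷ w b))) (conj-++ (w ^ʷ b) _)
  zu≡uy : z ++ u ≡ u ++ (conj w r ^ʷ (n ∸ b) ++ x ++ conj w r ^ʷ b)
  zu≡uy = trans (cong (λ y → ((y ^ʷ (n ∸ b) ++ m) ++ y ^ʷ b) ++ u) (sym (take++drop≡id r w)))
                (^ʷ-conjugate u (drop r w) m x (n ∸ b) b mu≡ux)
  u≤z : length u ≤ length z
  u≤z = subst₂ _≤_ (sym (length-take-≤ w r≤w))
          (trans (sym (length-conj _ (b * length w))) (cong length rotate))
          (≤-trans (m≤n+m r (b * length w)) fits)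

-- Primitive words

PowersOfCommonWord : Word → Word → Set
PowersOfCommonWord u v = ∃ λ z → ∃₂ λ m n → u ≡ z ^ʷ m × v ≡ z ^ʷ n

IsProperPower : Word → Set
IsProperPower w = ∃₂ λ z n → 2 ≤ n × w ≡ z ^ʷ n

commuting-prefix : ∀ (u v : Word) → length u ≤ length v → u ++ v ≡ v ++ u →
                   ∃ λ v′ → v ≡ u ++ v′ × u ++ v′ ≡ v′ ++ u
commuting-prefix u v u≤v uv≡vu = v′ , v≡uv′ , ++-cancelˡ u _ _ (begin
  u ++ (u ++ v′)  ≡⟨ cong (u ++_) v≡uv′ ⟨
  u ++ v          ≡⟨ uv≡vu ⟩
  v ++ u          ≡⟨ cong (_++ u) v≡uv′ ⟩
  (u ++ v′) ++ u  ≡⟨ ++-assoc u v′ u ⟩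
  u ++ (v′ ++ u)  ∎)
  where
  v′ = drop (length u) v
  u-prefix : take (length u) v ≡ u
  u-prefix = trans (sym (take-++ˡ v u u≤v))
               (trans (cong (take (length u)) (sym uv≡vu)) (take-length u v))
  v≡uv′ : v ≡ u ++ v′
  v≡uv′ = trans (sym (take++drop≡id (length u) v)) (cong (_++ v′) u-prefix)

-- Lyndon–Schützenberger; f bounds |u| + |v|.
commuting⇒powers : ∀ (u v : Word) → u ++ v ≡ v ++ u → PowersOfCommonWord u v
commuting⇒powers u v = go (length u + length v) u v ≤-refl
  where
  go   : ∀ f (u v : Word) → length u + length v ≤ f → u ++ v ≡ v ++ u → PowersOfCommonWord u v
  peel : ∀ f (u v : Word) → 1 ≤ length u → length u ≤ length v → length u + length v ≤ suc f →
         u ++ v ≡ v ++ u → PowersOfCommonWord u v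

  go f       []        v  _ _ = v , 0 , 1 , refl , sym (++-identityʳ v)
  go f       u@(_ ∷ _) [] _ _ = u , 1 , 0 , sym (++-identityʳ u) , refl
  go (suc f) u@(_ ∷ _) v@(_ ∷ _) bound uv≡vu with ≤-total (length u) (length v)
  ... | inj₁ u≤v = peel f u v (s≤s z≤n) u≤v bound uv≡vu
  ... | inj₂ v≤u
    with peel f v u (s≤s z≤n) v≤u (subst (_≤ suc f) (+-comm (length u) _) bound) (sym uv≡vu)
  ...   | z , m , n , v≡ , u≡ = z , n , m , u≡ , v≡

  peel f u v 1≤u u≤v bound uv≡vu with commuting-prefix u v u≤v uv≡vu
  ... | v′ , refl , uv′≡v′u with go f u v′ bound′ uv′≡v′u
    where
    bound′ : length u + length v′ ≤ f
    bound′ = ≤-pred (≤-trans (+-monoˡ-≤ (length u + length v′) 1≤u)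
                      (subst (λ n → length u + n ≤ suc f) (length-++ u) bound))
  ...   | z , m , n , refl , refl = z , m , m + n , refl , sym (^ʷ-+ z m n)

conj-fixed⇒IsProperPower : ∀ (w : Word) {d} → 1 ≤ d → d < length w → conj w d ≡ w →
                           IsProperPower w
conj-fixed⇒IsProperPower w {d} 1≤d d<w fixed
  with commuting⇒powers (take d w) (drop d w) (trans (take++drop≡id d w) (sym fixed))
... | z , zero , n , take≡ , _ =
  contradiction (trans (sym (length-take-≤ w (<⇒≤ d<w))) (cong length take≡)) (>⇒≢ 1≤d)
... | z , suc m , zero , _ , drop≡ =
  contradiction (trans (sym (length-drop d w)) (cong length drop≡)) (>⇒≢ (m<n⇒0<n∸m d<w))
... | z , suc m , suc n , take≡ , drop≡ =
  z , suc m + suc n , +-mono-≤ (s≤s z≤n) (s≤s z≤n) ,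
  trans (sym (take++drop≡id d w)) (trans (cong₂ _++_ take≡ drop≡) (sym (^ʷ-+ z (suc m) (suc n))))

coprime⇒¬IsProperPower : ∀ (w : Word) → Coprime (length w) (sum w) → ¬ IsProperPower w
coprime⇒¬IsProperPower w coprime (z , n , 2≤n , refl) =
  contradiction (coprime (n∣ (length-^ʷ z n) , n∣ (sum-^ʷ z n))) (>⇒≢ 2≤n)
  where
  n∣ : ∀ {m k} → m ≡ n * k → n ∣ m
  n∣ {k = k} m≡ = divides k (trans m≡ (*-comm n k))

conj-injective-≤ : ∀ (w : Word) {i j} → Coprime (length w) (sum w) → i ≤ j → j < length w →
                   conj w i ≡ conj w j → i ≡ j
conj-injective-≤ w {i} coprime i≤j j< eq with m≤n⇒∃[o]m+o≡n i≤j
... | zero  , refl = sym (+-identityʳ i)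
... | suc d , refl = contradiction
      (conj-fixed⇒IsProperPower (conj w i) (s≤s z≤n) d<
         (trans (conj-conj w i (suc d) (<⇒≤ j<)) (sym eq)))
      (coprime⇒¬IsProperPower (conj w i)
         (subst₂ Coprime (sym (length-conj w i)) (sym (sum-conj w i)) coprime))
  where
  d< : suc d < length (conj w i)
  d< = subst (suc d <_) (sym (length-conj w i)) (≤-<-trans (m≤n+m (suc d) i) j<)

conj-injective : ∀ (w : Word) {i j} → Coprime (length w) (sum w) → i < length w → j < length w →
                 conj w i ≡ conj w j → i ≡ j
conj-injective w {i} {j} coprime i< j< eq with ≤-total i j
... | inj₁ i≤j = conj-injective-≤ w coprime i≤j j< eq
... | inj₂ j≤i = sym (conj-injective-≤ w coprime j≤i i< (sym eq))

conj-init-injective : ∀ (w : Word) {i j} → Coprime (length w) (sum w) →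
                      i < length w → j < length w →
                      conj w i ≡[ length w ∸ 1 ] conj w j → i ≡ j
conj-init-injective w {i} {j} coprime i< j< init = conj-injective w coprime i< j<
  (≡-from-init-sum (conj w i) (conj w j) (trans (length-conj w i) (sym (length-conj w j)))
     (subst (λ n → conj w i ≡[ n ∸ 1 ] conj w j) (sym (length-conj w i)) init)
     (trans (sum-conj w i) (sym (sum-conj w j))))

-- Continuants and standard words

zeros : ℕ → Word
zeros n = (0 ∷ []) ^ʷ n

module _ (a : ℕ → ℕ) where

  sum-M : ∀ k → sum (M a k) ≡ p a k
  sum-M zero          = refl
  sum-M (suc zero)    = begin
    sum (zeros (a 1 ∸ 1) ++ 1 ∷ [])  ≡⟨ sum-++ (zeros (a 1 ∸ 1)) _ ⟩
    sum (zeros (a 1 ∸ 1)) + 1        ≡⟨ cong (_+ 1) (sum-^ʷ (0 ∷ []) (a 1 ∸ 1)) ⟩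
    (a 1 ∸ 1) * 0 + 1                ≡⟨ cong (_+ 1) (*-zeroʳ (a 1 ∸ 1)) ⟩
    1                                ∎
  sum-M (suc (suc k)) = begin
    sum (W ^ʷ a′ ++ M a k)       ≡⟨ sum-++ (W ^ʷ a′) _ ⟩
    sum (W ^ʷ a′) + sum (M a k)  ≡⟨ cong₂ _+_ (sum-^ʷ W a′) (sum-M k) ⟩
    a′ * sum W + p a k           ≡⟨ cong (λ n → a′ * n + p a k) (sum-M (suc k)) ⟩
    a′ * p a (suc k) + p a k     ∎
    where
    a′ = a (suc (suc k))
    W = M a (suc k)

  private
    cross : ℕ → ℕ
    cross k = a (suc (suc k)) * p a (suc k) * q a (suc k)

    p-expand : ∀ k → p a (suc (suc k)) * q a (suc k) ≡ cross k + p a k * q a (suc k)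
    p-expand k = *-distribʳ-+ (q a (suc k)) (a (suc (suc k)) * p a (suc k)) (p a k)

    q-expand : ∀ k → p a (suc k) * q a (suc (suc k)) ≡ cross k + p a (suc k) * q a k
    q-expand k = trans (*-distribˡ-+ P (a′ * Q) (q a k))
      (cong (_+ P * q a k) (trans (sym (*-assoc P a′ Q)) (cong (_* Q) (*-comm P a′))))
      where
      P = p a (suc k)
      Q = q a (suc k)
      a′ = a (suc (suc k))

  convergents-det : ∀ k → p a (suc k) * q a k ≡ p a k * q a (suc k) + 1
                        ⊎ p a k * q a (suc k) ≡ p a (suc k) * q a k + 1
  convergents-det zero = inj₁ refl
  convergents-det (suc k) with convergents-det k
  ... | inj₁ e = inj₂ (trans (q-expand k) (trans (+-suc-shift (cross k) e) (cong (_+ 1) (sym (p-expand k)))))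
  ... | inj₂ e = inj₁ (trans (p-expand k) (trans (+-suc-shift (cross k) e) (cong (_+ 1) (sym (q-expand k)))))

  q-p-coprime : ∀ k → Coprime (q a k) (p a k)
  q-p-coprime k {d} (d∣q , d∣p) with convergents-det k
  ... | inj₁ e = ∣1⇒≡1 (∣m+n∣m⇒∣n (subst (d ∣_) e (∣n⇒∣m*n (p a (suc k)) d∣q))
                                  (∣m⇒∣m*n (q a (suc k)) d∣p))
  ... | inj₂ e = ∣1⇒≡1 (∣m+n∣m⇒∣n (subst (d ∣_) e (∣m⇒∣m*n (q a (suc k)) d∣p))
                                  (∣n⇒∣m*n (p a (suc k)) d∣q))

  M₁-split : ∀ {r} → r < a 1 → M a 1 ≡ zeros r ++ (zeros (a 1 ∸ 1 ∸ r) ++ 1 ∷ [])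
  M₁-split {r} r<a₁ = begin
    zeros (a 1 ∸ 1) ++ 1 ∷ []                   ≡⟨ cong (λ n → zeros n ++ 1 ∷ []) r+c≡ ⟨
    zeros (r + c) ++ 1 ∷ []                     ≡⟨ cong (_++ 1 ∷ []) (^ʷ-+ (0 ∷ []) r c) ⟩
    (zeros r ++ zeros c) ++ 1 ∷ []              ≡⟨ ++-assoc (zeros r) (zeros c) _ ⟩
    zeros r ++ (zeros c ++ 1 ∷ [])              ∎
    where
    c = a 1 ∸ 1 ∸ r
    r+c≡ : r + c ≡ a 1 ∸ 1
    r+c≡ = m+[n∸m]≡n (<⇒≤pred r<a₁)

  take-M₁ : ∀ {r} → r < a 1 → take r (M a 1) ≡ zeros r
  take-M₁ {r} r<a₁ =
    trans (cong₂ take (sym (length-letter^ʷ 0 r)) (M₁-split r<a₁)) (take-length (zeros r) _)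

  conj-M₁ : ∀ {r} → r < a 1 → conj (M a 1) r ≡ zeros (a 1 ∸ 1 ∸ r) ++ (1 ∷ []) ++ zeros r
  conj-M₁ {r} r<a₁ = begin
    conj (M a 1) r                           ≡⟨ cong₂ conj (M₁-split r<a₁) (sym (length-letter^ʷ 0 r)) ⟩
    conj (zeros r ++ v) (length (zeros r))   ≡⟨ conj-++ (zeros r) v ⟩
    v ++ zeros r                             ≡⟨ ++-assoc (zeros (a 1 ∸ 1 ∸ r)) (1 ∷ []) _ ⟩
    zeros (a 1 ∸ 1 ∸ r) ++ (1 ∷ []) ++ zeros r ∎
    where v = zeros (a 1 ∸ 1 ∸ r) ++ 1 ∷ []

module _ (a : ℕ → ℕ) (a≥1 : ∀ k → 1 ≤ a (suc k)) where

  length-M : ∀ k → length (M a k) ≡ q a k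
  length-M zero          = refl
  length-M (suc zero)    = begin
    length (zeros (a 1 ∸ 1) ++ 1 ∷ [])  ≡⟨ length-++ (zeros (a 1 ∸ 1)) ⟩
    length (zeros (a 1 ∸ 1)) + 1        ≡⟨ cong (_+ 1) (length-letter^ʷ 0 (a 1 ∸ 1)) ⟩
    a 1 ∸ 1 + 1                         ≡⟨ m∸n+n≡m (a≥1 0) ⟩
    a 1                                 ∎
  length-M (suc (suc k)) = begin
    length (W ^ʷ a′ ++ M a k)          ≡⟨ length-++ (W ^ʷ a′) ⟩
    length (W ^ʷ a′) + length (M a k)  ≡⟨ cong₂ _+_ (length-^ʷ W a′) (length-M k) ⟩
    a′ * length W + q a k              ≡⟨ cong (λ n → a′ * n + q a k) (length-M (suc k)) ⟩
    a′ * q a (suc k) + q a k           ∎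
    where
    a′ = a (suc (suc k))
    W = M a (suc k)

  length-M^ʷ : ∀ k b → length (M a k ^ʷ b) ≡ b * q a k
  length-M^ʷ k b = trans (length-^ʷ (M a k) b) (cong (b *_) (length-M k))

  q-mono : ∀ k → q a k ≤ q a (suc k)
  q-mono zero    = a≥1 0
  q-mono (suc k) = ≤-trans (m≤n*m (q a (suc k)) (a (suc (suc k))) {{>-nonZero (a≥1 (suc k))}})
                           (m≤m+n _ (q a k))

  q-pos : ∀ k → 1 ≤ q a k
  q-pos zero    = ≤-refl
  q-pos (suc k) = ≤-trans (q-pos k) (q-mono k)

  q-pred : ∀ k → q a (suc (suc k)) ∸ 1 ≡ a (suc (suc k)) * q a (suc k) + (q a k ∸ 1)
  q-pred k = +-∸-assoc (a (suc (suc k)) * q a (suc k)) (q-pos k)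

  M-conj-init-injective : ∀ k {i j} → i < q a k → j < q a k →
                          conj (M a k) i ≡[ q a k ∸ 1 ] conj (M a k) j → i ≡ j
  M-conj-init-injective k {i} {j} i< j< init = conj-init-injective (M a k)
    (subst₂ Coprime (sym (length-M k)) (sym (sum-M a k)) (q-p-coprime a k))
    (subst (i <_) (sym (length-M k)) i<) (subst (j <_) (sym (length-M k)) j<)
    (subst (λ n → conj (M a k) i ≡[ n ∸ 1 ] conj (M a k) j) (sym (length-M k)) init)

  M-unfold : ∀ k → M a (suc (suc k)) ≡ M a (suc k) ++ (M a (suc k) ^ʷ (a (suc (suc k)) ∸ 1) ++ M a k)
  M-unfold k = trans (cong (_++ M a k) (^ʷ-pred W (a≥1 (suc k)))) (++-assoc W _ (M a k))
    where W = M a (suc k)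

  M-init : ∀ k → M a k ≡[ q a k ∸ 1 ] M a (suc k)
  M-init zero    = refl
  M-init (suc k) = sym (trans (cong (take (Q ∸ 1)) (M-unfold k)) (take-++ˡ W _ Q∸1≤W))
    where
    W = M a (suc k)
    Q = q a (suc k)
    Q∸1≤W : Q ∸ 1 ≤ length W
    Q∸1≤W = subst (Q ∸ 1 ≤_) (sym (length-M (suc k))) (m∸n≤m Q 1)

  M-almost-commute : ∀ k → M a k ++ M a (suc k) ≡[ (q a k ∸ 1) + (q a (suc k) ∸ 1) ] M a (suc k) ++ M a k
  M-almost-commute zero = trans (zeros-prefix (0 ∷ 1 ∷ []) M₀M₁)
                                (sym (zeros-prefix (1 ∷ 0 ∷ []) (++-assoc (zeros (a 1 ∸ 1)) _ _)))
    where
    zeros-prefix : ∀ {w} ys → w ≡ zeros (a 1 ∸ 1) ++ ys → take (a 1 ∸ 1) w ≡ zeros (a 1 ∸ 1)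
    zeros-prefix ys refl = trans (cong (λ n → take n (zeros (a 1 ∸ 1) ++ ys)) (sym (length-letter^ʷ 0 _)))
                                 (take-length (zeros (a 1 ∸ 1)) ys)
    M₀M₁ : (0 ∷ []) ++ zeros (a 1 ∸ 1) ++ 1 ∷ [] ≡ zeros (a 1 ∸ 1) ++ 0 ∷ 1 ∷ []
    M₀M₁ = trans (sym (++-assoc (0 ∷ []) (zeros (a 1 ∸ 1)) _))
             (trans (cong (_++ 1 ∷ []) (^ʷ-comm (0 ∷ []) (a 1 ∸ 1))) (++-assoc (zeros (a 1 ∸ 1)) _ _))
  M-almost-commute (suc k) =
    ≡[]-cong (sym WC≡) (sym bound) (sym (++-assoc (W ^ʷ a′) U W))
             (≡[]-++ (W ^ʷ a′) (sym (M-almost-commute k)))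
    where
    W = M a (suc k)
    U = M a k
    a′ = a (suc (suc k))
    n = (q a k ∸ 1) + (q a (suc k) ∸ 1)
    WC≡ : W ++ (W ^ʷ a′ ++ U) ≡ W ^ʷ a′ ++ (W ++ U)
    WC≡ = trans (sym (++-assoc W _ U)) (trans (cong (_++ U) (^ʷ-comm W a′)) (++-assoc (W ^ʷ a′) W U))
    bound : (q a (suc k) ∸ 1) + (q a (suc (suc k)) ∸ 1) ≡ length (W ^ʷ a′) + n
    bound = begin
      (q a (suc k) ∸ 1) + (q a (suc (suc k)) ∸ 1)             ≡⟨ cong ((q a (suc k) ∸ 1) +_) (q-pred k) ⟩
      (q a (suc k) ∸ 1) + (a′ * q a (suc k) + (q a k ∸ 1))    ≡⟨ +-comm (q a (suc k) ∸ 1) _ ⟩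
      a′ * q a (suc k) + (q a k ∸ 1) + (q a (suc k) ∸ 1)      ≡⟨ +-assoc (a′ * q a (suc k)) _ _ ⟩
      a′ * q a (suc k) + n                                    ≡⟨ cong (_+ n) (length-M^ʷ (suc k) a′) ⟨
      length (W ^ʷ a′) + n                                    ∎

  module _ (k : ℕ) where
    private
      W  = M a (suc k)
      U  = M a k
      C  = M a (suc (suc k))
      Q  = q a (suc k)
      P  = q a k
      a′ = a (suc (suc k))
      N  = a′ * Q + ((P ∸ 1) + (Q ∸ 1))

      |W| : length W ≡ Q
      |W| = length-M (suc k)

      ≤|W| : ∀ {i} → i ≤ Q → i ≤ length W
      ≤|W| = subst (_ ≤_) (sym |W|)

      <|C| : ∀ {j} → j < q a (suc (suc k)) → j ≤ length C
      <|C| j< = subst (_ ≤_) (sym (length-M (suc (suc k)))) (<⇒≤ j<)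

      window-fits : ∀ {j} → j < q a (suc (suc k)) → j + (Q ∸ 1) ≤ N
      window-fits {j} j< =
        ≤-trans (+-monoˡ-≤ (Q ∸ 1) (subst (j ≤_) (q-pred k) (<⇒≤pred j<)))
                (≤-reflexive (+-assoc (a′ * Q) (P ∸ 1) (Q ∸ 1)))

    M²-periodic : C ++ C ≡[ N ] W ^ʷ a′ ++ (W ++ W)
    M²-periodic = ≡[]-cong (sym CC≡) (cong (_+ n) (length-M^ʷ (suc k) a′)) refl (≡[]-++ (W ^ʷ a′) UW≡WW)
      where
      n = (P ∸ 1) + (Q ∸ 1)
      S = W ^ʷ (a′ ∸ 1) ++ U
      CC≡ : C ++ C ≡ W ^ʷ a′ ++ ((U ++ W) ++ S)
      CC≡ = begin
        (W ^ʷ a′ ++ U) ++ C         ≡⟨ ++-assoc (W ^ʷ a′) U C ⟩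
        W ^ʷ a′ ++ (U ++ C)         ≡⟨ cong (λ v → W ^ʷ a′ ++ (U ++ v)) (M-unfold k) ⟩
        W ^ʷ a′ ++ (U ++ (W ++ S))  ≡⟨ cong (W ^ʷ a′ ++_) (++-assoc U W S) ⟨
        W ^ʷ a′ ++ ((U ++ W) ++ S)  ∎
      n≤UW : n ≤ length (U ++ W)
      n≤UW = subst (n ≤_) (sym (trans (length-++ U) (cong₂ _+_ (length-M k) |W|)))
               (+-mono-≤ (m∸n≤m P 1) (m∸n≤m Q 1))
      n≤WP : n ≤ length W + (P ∸ 1)
      n≤WP = subst (n ≤_) (+-comm (P ∸ 1) (length W)) (+-monoʳ-≤ (P ∸ 1) (≤|W| (m∸n≤m Q 1)))
      UW≡WW : (U ++ W) ++ S ≡[ n ] W ++ W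
      UW≡WW = begin
        take n ((U ++ W) ++ S)  ≡⟨ take-++ˡ (U ++ W) S n≤UW ⟩
        take n (U ++ W)         ≡⟨ M-almost-commute k ⟩
        take n (W ++ U)         ≡⟨ ≡[]-mono n≤WP (≡[]-++ W (M-init k)) ⟩
        take n (W ++ W)         ∎

    take-M-periodic : ∀ {b r} → b ≤ a′ → r ≤ Q → b * Q + r < q a (suc (suc k)) →
                      take (b * Q + r) C ≡ W ^ʷ b ++ take r W
    take-M-periodic {b} {r} b≤ r≤ j< = begin
      take j C                                  ≡⟨ take-++ˡ C C (<|C| j<) ⟨
      take j (C ++ C)                           ≡⟨ ≡[]-mono j≤N M²-periodic ⟩
      take j (W ^ʷ a′ ++ (W ++ W))              ≡⟨ cong (take j) (^ʷ-++-square W b≤) ⟩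
      take j (W ^ʷ b ++ S)                      ≡⟨ cong (λ n → take (n + r) (W ^ʷ b ++ S)) |W^b| ⟨
      take (length (W ^ʷ b) + r) (W ^ʷ b ++ S)  ≡⟨ take-length-+ (W ^ʷ b) S r ⟩
      W ^ʷ b ++ take r S                        ≡⟨ cong (W ^ʷ b ++_) (take-++ˡ W _ (≤|W| r≤)) ⟩
      W ^ʷ b ++ take r W                        ∎
      where
      j = b * Q + r
      S = W ++ (W ++ W ^ʷ (a′ ∸ b))
      |W^b| = length-M^ʷ (suc k) b
      j≤N : j ≤ N
      j≤N = ≤-trans (m≤m+n j (Q ∸ 1)) (window-fits j<)

    conj-M-periodic : ∀ {b i} → b ≤ a′ → i ≤ Q → b * Q + i < q a (suc (suc k)) →
                      conj C (b * Q + i) ≡[ Q ∸ 1 ] conj W i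
    conj-M-periodic {b} {i} b≤ i≤ j< = begin
      take (Q ∸ 1) (conj C j)
        ≡⟨ cong (take (Q ∸ 1)) (take-drop-++ C C (<|C| j<)) ⟨
      take (Q ∸ 1) (take (length C) (drop j (C ++ C)))
        ≡⟨ take-take-≤ _ Q∸1≤C ⟩
      take (Q ∸ 1) (drop j (C ++ C))
        ≡⟨ ≡[]-drop j (≡[]-mono (window-fits j<) M²-periodic) ⟩
      take (Q ∸ 1) (drop j (W ^ʷ a′ ++ (W ++ W)))
        ≡⟨ cong (λ v → take (Q ∸ 1) (drop j v)) (^ʷ-++-square W b≤) ⟩
      take (Q ∸ 1) (drop j (W ^ʷ b ++ (W ++ S)))
        ≡⟨ cong (take (Q ∸ 1)) drop-blocks ⟩
      take (Q ∸ 1) (drop i (W ++ S))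
        ≡⟨ take-take-≤ _ (≤|W| (m∸n≤m Q 1)) ⟨
      take (Q ∸ 1) (take (length W) (drop i (W ++ S)))
        ≡⟨ cong (take (Q ∸ 1)) (take-drop-++ W S (≤|W| i≤)) ⟩
      take (Q ∸ 1) (drop i W ++ take i S)
        ≡⟨ cong (λ v → take (Q ∸ 1) (drop i W ++ v)) (take-++ˡ W _ (≤|W| i≤)) ⟩
      take (Q ∸ 1) (conj W i)
        ∎
      where
      j = b * Q + i
      S = W ++ W ^ʷ (a′ ∸ b)
      Q∸1≤C : Q ∸ 1 ≤ length C
      Q∸1≤C = subst (Q ∸ 1 ≤_) (sym (length-M (suc (suc k)))) (≤-trans (m∸n≤m Q 1) (q-mono (suc k)))
      drop-blocks : drop j (W ^ʷ b ++ (W ++ S)) ≡ drop i (W ++ S)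
      drop-blocks = trans (cong (λ n → drop (n + i) (W ^ʷ b ++ (W ++ S))) (sym (length-M^ʷ (suc k) b)))
                          (drop-length-+ (W ^ʷ b) _ i)

-- The conjugates V_k

module _ (a : ℕ → ℕ) (a≥1 : ∀ k → 1 ≤ a (suc k))
         (s : ℕ → ℕ) (t : ℕ → ℕ) (vt : IsVt a s t) where

  private
    t<q : ∀ k → t (suc k) < q a (suc k)
    t<q k = proj₁ (proj₂ vt k)

    V-prefix : ∀ k → take (q a (suc k) ∸ 1) (V a t (suc k)) ≡ prefix s (q a (suc k) ∸ 1)
    V-prefix k = proj₂ (proj₂ vt k)

  V-prefix-agree : ∀ k → V a t (suc (suc k)) ≡[ q a (suc k) ∸ 1 ] V a t (suc k)
  V-prefix-agree k = begin
    take n (V a t (suc (suc k)))                                   ≡⟨ take-take-≤ _ n≤ ⟨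
    take n (take (q a (suc (suc k)) ∸ 1) (V a t (suc (suc k))))   ≡⟨ cong (take n) (V-prefix (suc k)) ⟩
    take n (prefix s (q a (suc (suc k)) ∸ 1))                      ≡⟨ take-prefix s n≤ ⟩
    prefix s n                                                     ≡⟨ V-prefix k ⟨
    take n (V a t (suc k))                                         ∎
    where
    n = q a (suc k) ∸ 1
    n≤ : n ≤ q a (suc (suc k)) ∸ 1
    n≤ = ∸-monoˡ-≤ 1 (q-mono a a≥1 (suc k))

  t-recurrence : ∀ k → ∃ λ b → b ≤ a (suc (suc k)) × t (suc (suc k)) ≡ b * q a (suc k) + t (suc k)
  t-recurrence k with quotient-remainder (t (suc (suc k))) (q-pos a a≥1 (suc k))
  ... | b , i , i<Q , t≡ = b , b≤ , trans t≡ (cong (b * q a (suc k) +_) i≡t)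
    where
    j< : b * q a (suc k) + i < q a (suc (suc k))
    j< = subst (_< q a (suc (suc k))) t≡ (t<q (suc k))
    b≤ : b ≤ a (suc (suc k))
    b≤ = quotient-≤ j< (q-mono a a≥1 k)
    i≡t : i ≡ t (suc k)
    i≡t = M-conj-init-injective a a≥1 (suc k) i<Q (t<q k)
      (trans (sym (conj-M-periodic a a≥1 k b≤ (<⇒≤ i<Q) j<))
        (trans (cong (λ j → take (q a (suc k) ∸ 1) (conj (M a (suc (suc k))) j)) (sym t≡))
          (V-prefix-agree k)))

  MT≡TV : ∀ k → M a k ++ take (t (suc k)) (M a (suc k)) ≡ take (t (suc k)) (M a (suc k)) ++ V a t k
  MT≡TV zero =
    subst (λ u → (0 ∷ []) ++ u ≡ u ++ (0 ∷ [])) (sym (take-M₁ a (t<q 0))) (^ʷ-comm (0 ∷ []) (t 1))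
  MT≡TV (suc k) with t-recurrence k
  ... | b , b≤ , t≡ =
    subst (λ u → W ++ u ≡ u ++ V a t (suc k)) (sym T≡) (^ʷ-take-conjugate W b (t (suc k)))
    where
    W = M a (suc k)
    T≡ : take (t (suc (suc k))) (M a (suc (suc k))) ≡ W ^ʷ b ++ take (t (suc k)) W
    T≡ = trans (cong (λ j → take j (M a (suc (suc k)))) t≡)
           (take-M-periodic a a≥1 k b≤ (<⇒≤ (t<q k)) (subst (_< q a (suc (suc k))) t≡ (t<q (suc k))))

  V₁-factorization : V a t 1 ≡ V a t 0 ^ʷ (a 1 ∸ 1 ∸ bstar a t 1) ++ (1 ∷ []) ++ V a t 0 ^ʷ bstar a t 1
  V₁-factorization = conj-M₁ a (t<q 0)

  V-factorization : ∀ k → V a t (suc (suc k))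
                          ≡ V a t (suc k) ^ʷ (a (suc (suc k)) ∸ bstar a t (suc (suc k)))
                            ++ V a t k ++ V a t (suc k) ^ʷ bstar a t (suc (suc k))
  V-factorization k with t-recurrence k
  ... | b , b≤ , t≡ = begin
    conj C (t (suc (suc k)))
      ≡⟨ cong (conj C) (trans t≡ (cong (λ n → b * n + r) (sym |W|))) ⟩
    conj C (b * length W + r)
      ≡⟨ conj-^ʷ-++ W (M a k) (V a t k) b≤ r≤W fits (MT≡TV k) ⟩
    conj W r ^ʷ (a′ ∸ b) ++ V a t k ++ conj W r ^ʷ b
      ≡⟨ cong (λ c → conj W r ^ʷ (a′ ∸ c) ++ V a t k ++ conj W r ^ʷ c) bstar≡b ⟨
    conj W r ^ʷ (a′ ∸ b*) ++ V a t k ++ conj W r ^ʷ b*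
      ∎
    where
    W = M a (suc k)
    C = M a (suc (suc k))
    Q = q a (suc k)
    r = t (suc k)
    a′ = a (suc (suc k))
    b* = bstar a t (suc (suc k))
    |W| = length-M a a≥1 (suc k)
    r≤W : r ≤ length W
    r≤W = subst (r ≤_) (sym |W|) (<⇒≤ (t<q k))
    fits : b * length W + r ≤ length C
    fits = subst₂ _≤_ (cong (λ n → b * n + r) (sym |W|)) (sym (length-M a a≥1 (suc (suc k))))
             (subst (_≤ q a (suc (suc k))) t≡ (<⇒≤ (t<q (suc k))))
    bstar≡b : b* ≡ b
    bstar≡b = begin
      (t (suc (suc k)) ∸ r) div Q  ≡⟨ cong (λ j → (j ∸ r) div Q) t≡ ⟩
      (b * Q + r ∸ r) div Q        ≡⟨ cong (_div Q) (m+n∸n≡m (b * Q) r) ⟩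
      (b * Q) div Q                ≡⟨ *-div-cancel b (q-pos a a≥1 (suc k)) ⟩
      b                            ∎

lemma3p4 : (a : ℕ → ℕ) → (∀ k → 1 ≤ a (suc k)) →
           (s : ℕ → ℕ) → Sturmian a s →
           (t : ℕ → ℕ) → IsVt a s t →
           (V a t 1 ≡ V a t 0 ^ʷ (a 1 ∸ 1 ∸ bstar a t 1) ++ (1 ∷ []) ++ V a t 0 ^ʷ bstar a t 1)
           × (∀ k → V a t (suc (suc k))
                      ≡ V a t (suc k) ^ʷ (a (suc (suc k)) ∸ bstar a t (suc (suc k)))
                        ++ V a t k ++ V a t (suc k) ^ʷ bstar a t (suc (suc k)))
lemma3p4 a a≥1 s _ t vt = V₁-factorization a a≥1 s t vt , V-factorization a a≥1 s t vt
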